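{- For any graph $G$ of order $n$ and maximum degree $\Delta=\Delta(G)\ge2$, $$\left\lceil \frac{2n}{\Delta}\right\rceil\le \gamma_{qtR}(G)\le n-\Delta(G)+2.$$
   Context: All graphs are finite, simple and undirected. For $f:V(G)\to\{0,1,2\}$ write $V_i=\{v:f(v)=i\}$, weight $\sum_v f(v)$. A quasi-total Roman dominating function (QTRDF) is a function $f:V(G)\to\{0,1,2\}$ such that every vertex $u$ with $f(u)=0$ is adjacent to some $v$ with $f(v)=2$, and every vertex $x$ that is isolated in the subgraph induced by $V_1\cup V_2$ satisfies $f(x)=1$. $\gamma_{qtR}(G)$ is the minimum weight of a QTRDF on $G$. -}

module Defs where

open import Data.Nat using (ℕ; zero; suc; _+_; _*_; _∸_; _⊔_; _≤_; _<_; NonZero)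
open import Data.Nat.DivMod using (_/_)
open import Data.Fin using (Fin)
open import Data.Bool using (Bool; true; false; if_then_else_)
open import Data.List using (List; map; foldr)
open import Data.Nat.ListAction using (sum)
open import Data.List using (allFin)
open import Data.Product using (Σ; _×_; ∃; ∃-syntax)
open import Data.Sum using (_⊎_)
open import Relation.Binary.PropositionalEquality using (_≡_)
open import Relation.Nullary using (¬_)

record Graph (n : ℕ) : Set where
  field
    adj   : Fin n → Fin n → Bool
    sym   : ∀ u v → adj u v ≡ adj v u
    irrefl : ∀ v → adj v v ≡ false
open Graph public

Adjacent : ∀ {n} → Graph n → Fin n → Fin n → Set
Adjacent G u v = adj G u v ≡ true

deg : ∀ {n} → Graph n → Fin n → ℕ
deg {n} G v = sum (map (λ u → if adj G v u then 1 else 0) (allFin n))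

-- maximum degree Δ(G) (0 for the empty graph)
maxDeg : ∀ {n} → Graph n → ℕ
maxDeg {n} G = foldr _⊔_ 0 (map (deg G) (allFin n))

Label : Set
Label = Fin 3

val : Label → ℕ
val Fin.zero = 0
val (Fin.suc Fin.zero) = 1
val (Fin.suc (Fin.suc Fin.zero)) = 2

weight : ∀ {n} → (Fin n → Label) → ℕ
weight {n} f = sum (map (λ v → val (f v)) (allFin n))

record IsQTRDF {n} (G : Graph n) (f : Fin n → Label) : Set where
  field
    dom : ∀ u → val (f u) ≡ 0 → ∃[ v ] (Adjacent G u v × val (f v) ≡ 2)
    -- every vertex isolated in G[V₁ ∪ V₂] has label 1
    -- (isolated in the induced subgraph: it lies in V₁ ∪ V₂ and has no
    --  neighbour in V₁ ∪ V₂)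
    iso : ∀ x → 1 ≤ val (f x) →
          (∀ y → Adjacent G x y → val (f y) ≡ 0) → val (f x) ≡ 1

IsGammaQtR : ∀ {n} → Graph n → ℕ → Set
IsGammaQtR {n} G k =
  (Σ (Fin n → Label) λ f → IsQTRDF G f × weight f ≡ k)
  × (∀ f → IsQTRDF G f → k ≤ weight f)

⌈_/_⌉ : (a b : ℕ) → .{{NonZero b}} → ℕ
⌈ a / b ⌉ = (a + b ∸ 1) / b

-- In a QTRDF f every vertex of V₀ has a neighbour in V₂, and every vertex of V₂
-- has a neighbour outside V₀ (otherwise it is isolated in G[V₁ ∪ V₂] but labelled 2), so it has
-- at most Δ − 1 neighbours in V₀. Double counting the V₀–V₂ edges gives |V₀| + |V₂| ≤ Δ|V₂|,
-- and as Δ ≥ 2 this yields 2n = 2(|V₀| + |V₁| + |V₂|) ≤ Δ(|V₁| + 2|V₂|) = Δ w(f).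
--
-- Upper bound. For a vertex v of maximum degree and a neighbour w of v, label v with 2, w with 1,
-- the other neighbours of v with 0 and every other vertex with 1: a QTRDF of weight n − Δ + 2.

module Submission where

open import Defs
open import Data.Nat using (ℕ; _+_; _*_; _∸_; _≤_; NonZero; >-nonZero)
open import Data.Nat.Properties using (≤-trans; n≤1+n)
open import Data.Product using (_×_)

open import Data.Nat using (zero; suc; _<_; _⊔_; z≤n; s≤s; s≤s⁻¹)
open import Data.Nat.Properties
open import Data.Nat.DivMod using (_/_; m<n*o⇒m/o<n)
open import Data.Nat.ListAction using (sum)
open import Data.Fin using (Fin; zero; suc)
open import Data.Fin.Patterns using (0F; 1F; 2F)
open import Data.Fin.Properties using (any?) renaming (_≟_ to _≟ᶠ_)
open import Data.Bool using (Bool; true; false; if_then_else_)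
open import Data.Bool.Properties using () renaming (_≟_ to _≟ᵇ_)
open import Data.List using (map; foldr; tabulate; allFin)
open import Data.List.Properties using (map-tabulate)
open import Data.Product using (∃-syntax; _,_)
open import Data.Sum using (inj₁; inj₂)
open import Function using (_∘_)
open import Relation.Nullary using (Dec; yes; no; does; contradiction)
open import Relation.Nullary.Decidable using (_×-dec_; ¬?; decidable-stable; dec-true; dec-false)
open import Relation.Binary.PropositionalEquality as ≡
  using (_≡_; _≢_; refl; cong; cong₂; subst; module ≡-Reasoning)
open import Algebra.Properties.CommutativeMonoid.Sum +-0-commutativeMonoid
  using (sum-syntax; ∑-comm; ∑-distrib-+; sum-cong-≗; sum-replicate-zero)
open import Algebra.Properties.Semiring.Sum +-*-semiring using (*-distribˡ-sum; *-distribʳ-sum)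
open import Algebra.Properties.CommutativeSemigroup *-commutativeSemigroup using (x∙yz≈y∙xz)

⌈/⌉≤ : ∀ m d .{{_ : NonZero d}} {w} → m ≤ d * w → ⌈ m / d ⌉ ≤ w
⌈/⌉≤ m (suc d) {w} m≤dw = s≤s⁻¹ (m<n*o⇒m/o<n (begin-strict
  m + suc d ∸ 1      ≡⟨ cong (_∸ 1) (+-suc m d) ⟩
  m + d              <⟨ +-monoʳ-< m ≤-refl ⟩
  m + suc d          ≤⟨ +-monoˡ-≤ (suc d) m≤dw ⟩
  suc d * w + suc d  ≡⟨ +-comm (suc d * w) (suc d) ⟩
  suc d + suc d * w  ≡⟨ cong (suc d +_) (*-comm (suc d) w) ⟩
  suc w * suc d      ∎))
  where open ≤-Reasoning

m+n≤o+p⇒m≤o∸n+p : ∀ m n o p → m + n ≤ o + p → m ≤ o ∸ n + p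
m+n≤o+p⇒m≤o∸n+p m n o p m+n≤o+p = +-cancelʳ-≤ n m (o ∸ n + p) (begin
  m + n            ≤⟨ m+n≤o+p ⟩
  o + p            ≤⟨ +-monoˡ-≤ p (m≤n+m∸n o n) ⟩
  n + (o ∸ n) + p  ≡⟨ +-assoc n (o ∸ n) p ⟩
  n + (o ∸ n + p)  ≡⟨ +-comm n (o ∸ n + p) ⟩
  o ∸ n + p + n    ∎)
  where open ≤-Reasoning

∑-tabulate : ∀ {n} (g : Fin n → ℕ) → sum (tabulate g) ≡ ∑[ i < n ] g i
∑-tabulate {zero}  g = refl
∑-tabulate {suc n} g = cong (g zero +_) (∑-tabulate (g ∘ suc))

∑-allFin : ∀ {n} (g : Fin n → ℕ) → sum (map g (allFin n)) ≡ ∑[ i < n ] g i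
∑-allFin g = ≡.trans (cong sum (map-tabulate (λ i → i) g)) (∑-tabulate g)

∑-const : ∀ n c → ∑[ i < n ] c ≡ n * c
∑-const zero    c = refl
∑-const (suc n) c = cong (c +_) (∑-const n c)

∑-mono-≤ : ∀ {n} {g h : Fin n → ℕ} → (∀ i → g i ≤ h i) → ∑[ i < n ] g i ≤ ∑[ i < n ] h i
∑-mono-≤ {zero}  g≤h = z≤n
∑-mono-≤ {suc n} g≤h = +-mono-≤ (g≤h zero) (∑-mono-≤ (g≤h ∘ suc))

∑-mono-< : ∀ {n} {g h : Fin n → ℕ} → (∀ i → g i ≤ h i) → ∀ j → g j < h j →
           ∑[ i < n ] g i < ∑[ i < n ] h i
∑-mono-< g≤h zero    gj<hj = +-mono-<-≤ gj<hj (∑-mono-≤ (g≤h ∘ suc))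
∑-mono-< g≤h (suc j) gj<hj = +-mono-≤-< (g≤h zero) (∑-mono-< (g≤h ∘ suc) j gj<hj)

term≤∑ : ∀ {n} (g : Fin n → ℕ) i → g i ≤ ∑[ j < n ] g j
term≤∑ g zero    = m≤m+n _ _
term≤∑ g (suc i) = ≤-trans (term≤∑ (g ∘ suc) i) (m≤n+m _ _)

∑>0⇒term>0 : ∀ {n} (g : Fin n → ℕ) → 0 < ∑[ i < n ] g i → ∃[ i ] 0 < g i
∑>0⇒term>0 {suc n} g ∑>0 with g zero in g₀≡
... | suc _ = zero , subst (0 <_) (≡.sym g₀≡) (s≤s z≤n)
... | zero with ∑>0⇒term>0 (g ∘ suc) ∑>0
...   | i , gi>0 = suc i , gi>0

⨆ : ∀ {n} → (Fin n → ℕ) → ℕ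
⨆ g = foldr _⊔_ 0 (tabulate g)

term≤⨆ : ∀ {n} (g : Fin n → ℕ) i → g i ≤ ⨆ g
term≤⨆ g zero    = m≤m⊔n _ _
term≤⨆ g (suc i) = ≤-trans (term≤⨆ (g ∘ suc) i) (m≤n⊔m _ _)

⨆-attained : ∀ {n} (g : Fin n → ℕ) → 0 < ⨆ g → ∃[ i ] g i ≡ ⨆ g
⨆-attained {suc n} g ⨆>0 with ⊔-sel (g zero) (⨆ (g ∘ suc))
... | inj₁ ⨆≡g₀ = zero , ≡.sym ⨆≡g₀
... | inj₂ ⨆≡⨆tail with ⨆-attained (g ∘ suc) (subst (0 <_) ⨆≡⨆tail ⨆>0)
...   | i , gi≡ = suc i , ≡.trans gi≡ (≡.sym ⨆≡⨆tail)

χ : Bool → ℕ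
χ b = if b then 1 else 0

χ-does-*-≤ : ∀ {P : Set} (p : Dec P) a → χ (does p) * a ≤ a
χ-does-*-≤ (yes _) a = ≤-reflexive (+-identityʳ a)
χ-does-*-≤ (no _)  a = z≤n

χ-does-*-mono : ∀ {P : Set} (p : Dec P) {a b} → (P → a ≤ b) → χ (does p) * a ≤ χ (does p) * b
χ-does-*-mono (yes P) a≤b = +-monoˡ-≤ 0 (a≤b P)
χ-does-*-mono (no _)  _   = z≤n

deg≡∑ : ∀ {n} (G : Graph n) v → deg G v ≡ ∑[ u < n ] χ (adj G v u)
deg≡∑ G v = ∑-allFin (λ u → χ (adj G v u))

maxDeg≡⨆ : ∀ {n} (G : Graph n) → maxDeg G ≡ ⨆ (deg G)
maxDeg≡⨆ G = cong (foldr _⊔_ 0) (map-tabulate (λ i → i) (deg G))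

deg≤maxDeg : ∀ {n} (G : Graph n) v → deg G v ≤ maxDeg G
deg≤maxDeg G v = subst (deg G v ≤_) (≡.sym (maxDeg≡⨆ G)) (term≤⨆ (deg G) v)

maxDeg-attained : ∀ {n} (G : Graph n) → 0 < maxDeg G → ∃[ v ] deg G v ≡ maxDeg G
maxDeg-attained G Δ>0 with ⨆-attained (deg G) (subst (0 <_) (maxDeg≡⨆ G) Δ>0)
... | v , degv≡ = v , ≡.trans degv≡ (≡.sym (maxDeg≡⨆ G))

deg>0⇒neighbour : ∀ {n} (G : Graph n) v → 0 < deg G v → ∃[ w ] Adjacent G v w
deg>0⇒neighbour G v deg>0 with ∑>0⇒term>0 (χ ∘ adj G v) (subst (0 <_) (deg≡∑ G v) deg>0)
... | w , χ>0 with adj G v w in v~w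
...   | true  = w , v~w
...   | false = contradiction χ>0 λ ()

∑-adj-swap : ∀ {n} (G : Graph n) (a b : Fin n → ℕ) →
             ∑[ u < n ] (a u * ∑[ v < n ] (b v * χ (adj G u v))) ≡
             ∑[ v < n ] (b v * ∑[ u < n ] (a u * χ (adj G v u)))
∑-adj-swap {n} G a b = begin
  ∑[ u < n ] (a u * ∑[ v < n ] (b v * χ (adj G u v)))     ≡⟨ sum-cong-≗ (λ u → *-distribˡ-sum (a u) (λ v → b v * χ (adj G u v))) ⟩
  ∑[ u < n ] ∑[ v < n ] (a u * (b v * χ (adj G u v)))     ≡⟨ ∑-comm (λ u v → a u * (b v * χ (adj G u v))) ⟩
  ∑[ v < n ] ∑[ u < n ] (a u * (b v * χ (adj G u v)))     ≡⟨ sum-cong-≗ (λ v → sum-cong-≗ (λ u → swap u v)) ⟩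
  ∑[ v < n ] ∑[ u < n ] (b v * (a u * χ (adj G v u)))     ≡⟨ sum-cong-≗ (λ v → *-distribˡ-sum (b v) (λ u → a u * χ (adj G v u))) ⟨
  ∑[ v < n ] (b v * ∑[ u < n ] (a u * χ (adj G v u)))     ∎
  where
  open ≡-Reasoning
  swap : ∀ u v → a u * (b v * χ (adj G u v)) ≡ b v * (a u * χ (adj G v u))
  swap u v rewrite Graph.sym G u v = x∙yz≈y∙xz (a u) (b v) _

𝟙 : ℕ → Label → ℕ
𝟙 i x = χ (does (val x ≟ i))

V₂-Supported : ∀ {n} → Graph n → (Fin n → Label) → Set
V₂-Supported G f = ∀ v → val (f v) ≡ 2 → ∃[ w ] (Adjacent G v w × val (f w) ≢ 0)

module _ {n} {G : Graph n} {f : Fin n → Label} where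

  qtrdf⇒V₂-supported : IsQTRDF G f → V₂-Supported G f
  qtrdf⇒V₂-supported f-qtrdf v fv≡2
    with any? (λ w → (adj G v w ≟ᵇ true) ×-dec ¬? (val (f w) ≟ 0))
  ... | yes supporter = supporter
  ... | no unsupported = contradiction (≡.trans (≡.sym fv≡2) fv≡1) λ ()
    where
    isolated : ∀ w → Adjacent G v w → val (f w) ≡ 0
    isolated w v~w = decidable-stable (val (f w) ≟ 0) λ fw≢0 → unsupported (w , v~w , fw≢0)
    fv≡1 : val (f v) ≡ 1
    fv≡1 = IsQTRDF.iso f-qtrdf v (subst (1 ≤_) (≡.sym fv≡2) (s≤s z≤n)) isolated

  V₂-supported⇒isolation-condition : V₂-Supported G f →
    ∀ x → 1 ≤ val (f x) → (∀ y → Adjacent G x y → val (f y) ≡ 0) → val (f x) ≡ 1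
  V₂-supported⇒isolation-condition supported x fx≥1 isolated with f x in fx≡
  ... | 1F = refl
  ... | 2F with supported x (cong val fx≡)
  ...   | w , x~w , fw≢0 = contradiction (isolated w x~w) fw≢0

module QTRDF-LowerBound {n} {G : Graph n} {f : Fin n → Label} (f-qtrdf : IsQTRDF G f) where

  ∣V_∣ : ℕ → ℕ
  ∣V i ∣ = ∑[ u < n ] 𝟙 i (f u)

  V₂-degree : Fin n → ℕ
  V₂-degree u = ∑[ v < n ] (𝟙 2 (f v) * χ (adj G u v))

  V₀-degree : Fin n → ℕ
  V₀-degree v = ∑[ u < n ] (𝟙 0 (f u) * χ (adj G v u))

  V₀-dominated : ∀ u → 𝟙 0 (f u) * 1 ≤ 𝟙 0 (f u) * V₂-degree u
  V₀-dominated u = χ-does-*-mono (val (f u) ≟ 0) λ fu≡0 →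
    let (v , u~v , fv≡2) = IsQTRDF.dom f-qtrdf u fu≡0 in
    ≤-trans (≤-reflexive (≡.sym (edge-term v u~v fv≡2))) (term≤∑ _ v)
    where
    edge-term : ∀ v → Adjacent G u v → val (f v) ≡ 2 → 𝟙 2 (f v) * χ (adj G u v) ≡ 1
    edge-term v u~v fv≡2 rewrite dec-true (val (f v) ≟ 2) fv≡2 | u~v = refl

  V₀-degree<deg : ∀ v → val (f v) ≡ 2 → V₀-degree v < deg G v
  V₀-degree<deg v fv≡2 with qtrdf⇒V₂-supported f-qtrdf v fv≡2
  ... | w , v~w , fw≢0 = subst (V₀-degree v <_) (≡.sym (deg≡∑ G v))
        (∑-mono-< (λ u → χ-does-*-≤ (val (f u) ≟ 0) _) w at-supporter)
    where
    at-supporter : 𝟙 0 (f w) * χ (adj G v w) < χ (adj G v w)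
    at-supporter rewrite dec-false (val (f w) ≟ 0) fw≢0 | v~w = s≤s z≤n

  V₂+V₀≤V₂*D : ∀ {D} → (∀ v → deg G v ≤ D) → ∣V 2 ∣ + ∣V 0 ∣ ≤ ∣V 2 ∣ * D
  V₂+V₀≤V₂*D {D} deg≤D = begin
    ∣V 2 ∣ + ∣V 0 ∣
      ≡⟨ cong (∣V 2 ∣ +_) (sum-cong-≗ λ u → ≡.sym (*-identityʳ (𝟙 0 (f u)))) ⟩
    ∣V 2 ∣ + ∑[ u < n ] (𝟙 0 (f u) * 1)
      ≤⟨ +-monoʳ-≤ ∣V 2 ∣ (∑-mono-≤ V₀-dominated) ⟩
    ∣V 2 ∣ + ∑[ u < n ] (𝟙 0 (f u) * V₂-degree u)
      ≡⟨ cong (∣V 2 ∣ +_) (∑-adj-swap G (λ u → 𝟙 0 (f u)) (λ v → 𝟙 2 (f v))) ⟩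
    ∣V 2 ∣ + ∑[ v < n ] (𝟙 2 (f v) * V₀-degree v)
      ≡⟨ ∑-distrib-+ (λ v → 𝟙 2 (f v)) (λ v → 𝟙 2 (f v) * V₀-degree v) ⟨
    ∑[ v < n ] (𝟙 2 (f v) + 𝟙 2 (f v) * V₀-degree v)
      ≡⟨ sum-cong-≗ (λ v → ≡.sym (*-suc (𝟙 2 (f v)) (V₀-degree v))) ⟩
    ∑[ v < n ] (𝟙 2 (f v) * suc (V₀-degree v))
      ≤⟨ ∑-mono-≤ (λ v → χ-does-*-mono (val (f v) ≟ 2) λ fv≡2 →
           ≤-trans (V₀-degree<deg v fv≡2) (deg≤D v)) ⟩
    ∑[ v < n ] (𝟙 2 (f v) * D)
      ≡⟨ *-distribʳ-sum D (λ v → 𝟙 2 (f v)) ⟨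
    ∣V 2 ∣ * D ∎
    where open ≤-Reasoning

  weight-lower-bound : ∀ {D} → 2 ≤ D → (∀ v → deg G v ≤ D) → 2 * n ≤ D * weight f
  weight-lower-bound {D} D≥2 deg≤D = +-cancelʳ-≤ (2 * (∣V 2 ∣ * D)) (2 * n) (D * weight f) (begin
    2 * n + 2 * (∣V 2 ∣ * D)                                    ≡⟨ ∑-left ⟨
    ∑[ v < n ] (2 + 2 * (𝟙 2 (f v) * D))                       ≤⟨ ∑-mono-≤ (λ v → label-bound (f v)) ⟩
    ∑[ v < n ] (D * val (f v) + 2 * (𝟙 2 (f v) + 𝟙 0 (f v)))  ≡⟨ ∑-right ⟩
    D * weight f + 2 * (∣V 2 ∣ + ∣V 0 ∣)                       ≤⟨ +-monoʳ-≤ (D * weight f) (*-monoʳ-≤ 2 (V₂+V₀≤V₂*D deg≤D)) ⟩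
    D * weight f + 2 * (∣V 2 ∣ * D)                            ∎)
    where
    open ≤-Reasoning
    label-bound : ∀ x → 2 + 2 * (𝟙 2 x * D) ≤ D * val x + 2 * (𝟙 2 x + 𝟙 0 x)
    label-bound 0F rewrite *-zeroʳ D = ≤-refl
    label-bound 1F rewrite *-identityʳ D | +-identityʳ D = D≥2
    label-bound 2F rewrite +-identityʳ D | *-comm D 2 = ≤-reflexive (+-comm 2 (2 * D))
    ∑-left : ∑[ v < n ] (2 + 2 * (𝟙 2 (f v) * D)) ≡ 2 * n + 2 * (∣V 2 ∣ * D)
    ∑-left = ≡.trans (∑-distrib-+ (λ _ → 2) (λ v → 2 * (𝟙 2 (f v) * D))) (cong₂ _+_
      (≡.trans (∑-const n 2) (*-comm n 2))
      (≡.trans (≡.sym (*-distribˡ-sum 2 (λ v → 𝟙 2 (f v) * D)))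
               (cong (2 *_) (≡.sym (*-distribʳ-sum D (λ v → 𝟙 2 (f v)))))))
    ∑-right : ∑[ v < n ] (D * val (f v) + 2 * (𝟙 2 (f v) + 𝟙 0 (f v))) ≡ D * weight f + 2 * (∣V 2 ∣ + ∣V 0 ∣)
    ∑-right = ≡.trans (∑-distrib-+ (λ v → D * val (f v)) (λ v → 2 * (𝟙 2 (f v) + 𝟙 0 (f v)))) (cong₂ _+_
      (≡.trans (≡.sym (*-distribˡ-sum D (λ v → val (f v)))) (cong (D *_) (≡.sym (∑-allFin (λ v → val (f v))))))
      (≡.trans (≡.sym (*-distribˡ-sum 2 (λ v → 𝟙 2 (f v) + 𝟙 0 (f v))))
               (cong (2 *_) (∑-distrib-+ (λ v → 𝟙 2 (f v)) (λ v → 𝟙 0 (f v))))))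

∑-δ : ∀ {n} (v : Fin n) → ∑[ u < n ] χ (does (u ≟ᶠ v)) ≡ 1
∑-δ {suc n} zero    = cong suc (sum-replicate-zero n)
∑-δ {suc n} (suc v) = ∑-δ v

module Star {n} (G : Graph n) {v w : Fin n} (v~w : Adjacent G v w) where

  star : Fin n → Label
  star u with u ≟ᶠ v | u ≟ᶠ w | adj G v u
  ... | yes _ | _     | _     = 2F
  ... | no _  | yes _ | _     = 1F
  ... | no _  | no _  | true  = 0F
  ... | no _  | no _  | false = 1F

  star-v : val (star v) ≡ 2
  star-v with v ≟ᶠ v
  ... | yes _ = refl
  ... | no v≢v = contradiction refl v≢v

  star-w : val (star w) ≡ 1
  star-w with w ≟ᶠ v | w ≟ᶠ w
  ... | yes refl | _      = contradiction (≡.trans (≡.sym v~w) (irrefl G w)) λ ()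
  ... | no _     | yes _  = refl
  ... | no _     | no w≢w = contradiction refl w≢w

  star-dom : ∀ u → val (star u) ≡ 0 → ∃[ y ] (Adjacent G u y × val (star y) ≡ 2)
  star-dom u star≡0 with u ≟ᶠ v | u ≟ᶠ w | adj G v u in v~u
  ... | no _ | no _ | true = v , ≡.trans (Graph.sym G u v) v~u , star-v

  star-V₂-supported : V₂-Supported G star
  star-V₂-supported x star≡2 with x ≟ᶠ v | x ≟ᶠ w | adj G v x
  ... | yes refl | _     | _     = w , v~w , subst (_≢ 0) (≡.sym star-w) λ ()
  star-V₂-supported x () | no _ | yes _ | _
  star-V₂-supported x () | no _ | no _  | true
  star-V₂-supported x () | no _ | no _  | false

  star-qtrdf : IsQTRDF G star
  star-qtrdf = record
    { dom = star-dom
    ; iso = V₂-supported⇒isolation-condition {G = G} {f = star} star-V₂-supported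
    }

  star-weight : weight star + deg G v ≤ n + 2
  star-weight = begin
    weight star + deg G v
      ≡⟨ cong₂ _+_ (∑-allFin (λ u → val (star u))) (deg≡∑ G v) ⟩
    ∑[ u < n ] val (star u) + ∑[ u < n ] χ (adj G v u)
      ≡⟨ ∑-distrib-+ (λ u → val (star u)) (λ u → χ (adj G v u)) ⟨
    ∑[ u < n ] (val (star u) + χ (adj G v u))
      ≤⟨ ∑-mono-≤ star-pointwise ⟩
    ∑[ u < n ] (1 + (χ (does (u ≟ᶠ v)) + χ (does (u ≟ᶠ w))))
      ≡⟨ ∑-distrib-+ (λ _ → 1) (λ u → χ (does (u ≟ᶠ v)) + χ (does (u ≟ᶠ w))) ⟩
    ∑[ u < n ] 1 + ∑[ u < n ] (χ (does (u ≟ᶠ v)) + χ (does (u ≟ᶠ w)))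
      ≡⟨ cong (∑[ u < n ] 1 +_) (∑-distrib-+ (λ u → χ (does (u ≟ᶠ v))) (λ u → χ (does (u ≟ᶠ w)))) ⟩
    ∑[ u < n ] 1 + (∑[ u < n ] χ (does (u ≟ᶠ v)) + ∑[ u < n ] χ (does (u ≟ᶠ w)))
      ≡⟨ cong₂ _+_ (≡.trans (∑-const n 1) (*-identityʳ n)) (cong₂ _+_ (∑-δ v) (∑-δ w)) ⟩
    n + 2 ∎
    where
    open ≤-Reasoning
    star-pointwise : ∀ u → val (star u) + χ (adj G v u) ≤ 1 + (χ (does (u ≟ᶠ v)) + χ (does (u ≟ᶠ w)))
    star-pointwise u with u ≟ᶠ v | u ≟ᶠ w | adj G v u in v~u
    ... | yes refl | _     | false = s≤s (s≤s z≤n)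
    ... | yes refl | _     | true  = contradiction (≡.trans (≡.sym v~u) (irrefl G u)) λ ()
    ... | no _     | yes _ | false = s≤s z≤n
    ... | no _     | yes _ | true  = ≤-refl
    ... | no _     | no _  | true  = ≤-refl
    ... | no _     | no _  | false = ≤-refl

mainTheorem6 : (n : ℕ) (G : Graph n) (Δ≥2 : 2 ≤ maxDeg G) (γ : ℕ) →
    IsGammaQtR G γ →
    (⌈ 2 * n / maxDeg G ⌉ {{>-nonZero (≤-trans (n≤1+n 1) Δ≥2)}} ≤ γ)
      × (γ ≤ n ∸ maxDeg G + 2)
mainTheorem6 n G Δ≥2 γ ((f , f-qtrdf , weight≡γ) , γ-minimal) = lower , upper
  where
  Δ>0 : 0 < maxDeg G
  Δ>0 = ≤-trans (s≤s z≤n) Δ≥2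

  lower : ⌈ 2 * n / maxDeg G ⌉ {{>-nonZero Δ>0}} ≤ γ
  lower = ⌈/⌉≤ (2 * n) (maxDeg G) {{>-nonZero Δ>0}}
    (subst (λ w → 2 * n ≤ maxDeg G * w) weight≡γ
      (QTRDF-LowerBound.weight-lower-bound f-qtrdf Δ≥2 (deg≤maxDeg G)))

  upper : γ ≤ n ∸ maxDeg G + 2
  upper with maxDeg-attained G Δ>0
  ... | v , degv≡Δ with deg>0⇒neighbour G v (subst (0 <_) (≡.sym degv≡Δ) Δ>0)
  ...   | w , v~w = ≤-trans (γ-minimal star star-qtrdf)
          (m+n≤o+p⇒m≤o∸n+p _ _ n 2 (subst (λ d → weight star + d ≤ n + 2) degv≡Δ star-weight))
    where open Star G v~w
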